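{- Let $p\ge5$ be a prime and $r$ a positive integer such that $3$ does not divide $p^r+1$. Then $A(x)=x^{p^r+2}$ is an Alltop polynomial on $\mathbb{F}_{p^{2r}}$.
   Context: For $f:\mathbb{F}_{q}\to\mathbb{F}_{q}$ and $a\in\mathbb{F}_{q}$ put $\Delta_{f,a}(x)=f(x+a)-f(x)$. A function $f$ is planar if $\Delta_{f,a}$ is a bijection of $\mathbb{F}_q$ for every $a\in\mathbb{F}_q^*$; $A$ is an Alltop polynomial if $\Delta_{A,a}$ is planar for every $a\in\mathbb{F}_q^*$. -}

module Defs where

open import Level using (0ℓ)
open import Data.Nat as ℕ using (ℕ; zero; suc)
open import Data.Fin using (Fin)
open import Data.Product using (∃)
open import Relation.Binary.PropositionalEquality using (_≡_; _≢_)
open import Algebra.Structures using (IsCommutativeRing)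
open import Function.Bundles using (_↔_)
open import Function.Definitions using (Bijective)

record FiniteField (q : ℕ) : Set₁ where
  infixl 6 _+_ _-_
  infixl 7 _*_
  field
    Carrier : Set
    _+_ _*_ : Carrier → Carrier → Carrier
    -_      : Carrier → Carrier
    0# 1#   : Carrier
    isCommutativeRing : IsCommutativeRing _≡_ _+_ _*_ -_ 0# 1#
    0≢1     : 0# ≢ 1#
    inverse : ∀ x → x ≢ 0# → ∃ λ y → x * y ≡ 1#
    enumeration : Carrier ↔ Fin q

  _-_ : Carrier → Carrier → Carrier
  x - y = x + (- y)

  _^_ : Carrier → ℕ → Carrier
  x ^ zero  = 1#
  x ^ suc n = x * (x ^ n)

module _ {q : ℕ} (F : FiniteField q) where
  open FiniteField F

  Δ : (Carrier → Carrier) → Carrier → Carrier → Carrier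
  Δ f a x = f (x + a) - f x

  Planar : (Carrier → Carrier) → Set
  Planar f = ∀ a → a ≢ 0# → Bijective _≡_ _≡_ (Δ f a)

  Alltop : (Carrier → Carrier) → Set
  Alltop A = ∀ a → a ≢ 0# → Planar (Δ A a)

module Submission where

-- Write q = p ^ r and φ x = x ^ q; on F = 𝔽_{q²} the map φ is an additive, multiplicative involution, and
-- A x = φ x · x².  Hence Δ_b Δ_a A x = 2 L x + K with L x = a b φ x + (φ a b + φ b a) x additive, so Δ_b Δ_a A
-- is a bijection as soon as L has trivial kernel.  If L d = 0 with d ≠ 0, applying φ gives a second linear
-- relation between d and φ d; the vanishing determinant says u² + u φu + (φu)² = 0 for u = a φb ≠ 0.  Then
-- t = φu / u satisfies t² + t + 1 = 0, so t³ = 1, while t^(q+1) = φt · t = 1; as 3 ∤ q + 1 this forces t = 1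
-- and 3 = 0 in F, impossible for p ≥ 5.  Characteristic p, x ^ (q²) = x and the additivity of φ follow from
-- |F| = q² by Lagrange's product argument and the binomial theorem.

open import Defs
open import Level using (0ℓ)
open import Algebra.Bundles using (Monoid; CommutativeMonoid; CommutativeSemiring; CommutativeRing)
import Algebra.Properties.CommutativeMonoid.Sum
open import Data.Nat as ℕ using (ℕ; zero; suc; _∸_; _<_; _≤_; s≤s; z≤n; _!)
import Data.Nat.Properties as ℕ
open import Data.Nat.Divisibility using (_∣_; divides; ∣⇒≤; ∣1⇒≡1; m∣m*n)
open import Data.Nat.Primality using (Prime; prime?; euclidsLemma; prime⇒irreducible; ¬prime[0]; ¬prime[1])
open import Data.Nat.Coprimality as Coprime using (Coprime; coprime-Bézout; prime⇒coprime)
import Data.Nat.GCD as GCD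
open import Data.Nat.Combinatorics using (_C_; nCn≡1; nCk≡n!/k![n-k]!; k![n∸k]!∣n!)
open import Data.Nat.DivMod using (_/_; m/n*n≡m)
open import Data.Fin as Fin using (Fin; zero; suc; fromℕ; inject₁; punchIn; punchOut)
import Data.Fin.Properties as Fin
open import Data.Fin.Permutation using (Permutation; _⟨$⟩ʳ_)
open import Data.Vec.Functional using (Vector; removeAt)
open import Data.Product using (_,_; proj₁; proj₂)
open import Data.Sum using (inj₁; inj₂)
open import Function using (_∘_)
open import Function.Bundles using (_↔_; Inverse; Injection; mk↔ₛ′)
open import Function.Construct.Composition using (_↔-∘_)
open import Function.Definitions using (Injective; Surjective; Bijective)
open import Function.Properties.Inverse using (↔⇒↣; ↔-sym)
open import Relation.Nullary using (¬_; yes; no; contradiction)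
open import Relation.Nullary.Decidable using (via-injection; from-yes)
open import Relation.Binary.Definitions using (DecidableEquality)
import Relation.Binary.PropositionalEquality as ≡
open ≡ using (_≡_; _≢_)

n!≡nCk*k![n∸k]! : ∀ {n k} → k ≤ n → n ! ≡ (n C k) ℕ.* (k ! ℕ.* (n ∸ k) !)
n!≡nCk*k![n∸k]! {n} {k} k≤n = begin
  n !                                                 ≡⟨ m/n*n≡m (k![n∸k]!∣n! k≤n) ⟨
  (n ! / (k ! ℕ.* (n ∸ k) !)) ℕ.* (k ! ℕ.* (n ∸ k) !) ≡⟨ ≡.cong (ℕ._* (k ! ℕ.* (n ∸ k) !)) (nCk≡n!/k![n-k]! k≤n) ⟨
  (n C k) ℕ.* (k ! ℕ.* (n ∸ k) !)                     ∎
  where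
  open ≡.≡-Reasoning
  instance _ = ℕ._!*_!≢0 k (n ∸ k)

prime∤! : ∀ {p m} → Prime p → m < p → ¬ p ∣ m !
prime∤! {m = zero}  pr _   p∣1 = ¬prime[1] (≡.subst Prime (∣1⇒≡1 p∣1) pr)
prime∤! {m = suc m} pr m<p p∣m! with euclidsLemma (suc m) (m !) pr p∣m!
... | inj₁ p∣m+1 = ℕ.<⇒≱ m<p (∣⇒≤ p∣m+1)
... | inj₂ p∣m!  = prime∤! pr (ℕ.<-trans (ℕ.n<1+n m) m<p) p∣m!

prime∣! : ∀ {p} → Prime p → p ∣ p !
prime∣! {zero}  pr = contradiction pr ¬prime[0]
prime∣! {suc p} _  = m∣m*n (p !)

prime∣C : ∀ {p k} → Prime p → 0 < k → k < p → p ∣ p C k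
prime∣C {p} {k} pr 0<k k<p
  with euclidsLemma (p C k) _ pr (≡.subst (p ∣_) (n!≡nCk*k![n∸k]! (ℕ.<⇒≤ k<p)) (prime∣! pr))
... | inj₁ p∣C = p∣C
... | inj₂ p∣k![p∸k]! with euclidsLemma (k !) ((p ∸ k) !) pr p∣k![p∸k]!
...   | inj₁ p∣k!     = contradiction p∣k! (prime∤! pr k<p)
...   | inj₂ p∣[p∸k]! = contradiction p∣[p∸k]! (prime∤! pr (ℕ.∸-monoʳ-< 0<k (ℕ.<⇒≤ k<p)))

prime∤⇒coprime : ∀ {p n} → Prime p → ¬ p ∣ n → Coprime p n
prime∤⇒coprime pr p∤n (d∣p , d∣n) with prime⇒irreducible pr d∣p
... | inj₁ d≡1    = d≡1
... | inj₂ ≡.refl = contradiction d∣n p∤n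

Fin-injective⇒surjective : ∀ {n} (g : Fin n → Fin n) → Injective _≡_ _≡_ g → Surjective _≡_ _≡_ g
Fin-injective⇒surjective {zero}  g g-inj ()
Fin-injective⇒surjective {suc n} g g-inj y with Fin.any? (λ i → g i Fin.≟ y)
... | yes (i , gi≡y) = i , λ { ≡.refl → gi≡y }
... | no ∄i = contradiction (Fin.injective⇒≤ h-inj) ℕ.1+n≰n
  where
  y≢g : ∀ i → y ≢ g i
  y≢g i y≡gi = ∄i (i , ≡.sym y≡gi)
  h : Fin (suc n) → Fin n
  h i = punchOut (y≢g i)
  h-inj : Injective _≡_ _≡_ h
  h-inj hi≡hj = g-inj (Fin.punchOut-injective (y≢g _) (y≢g _) hi≡hj)

finite-injective⇒bijective : ∀ {a} {A : Set a} {n} → A ↔ Fin n →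
                             (f : A → A) → Injective _≡_ _≡_ f → Bijective _≡_ _≡_ f
finite-injective⇒bijective A↔Fin f f-inj = f-inj , f-surj
  where
  open Inverse A↔Fin using (to; from)
  to-inj : Injective _≡_ _≡_ to
  to-inj = Injection.injective (↔⇒↣ A↔Fin)
  from-inj : Injective _≡_ _≡_ from
  from-inj = Injection.injective (↔⇒↣ (↔-sym A↔Fin))
  f-surj : Surjective _≡_ _≡_ f
  f-surj y with Fin-injective⇒surjective (λ i → to (f (from i))) (λ eq → from-inj (f-inj (to-inj eq))) (to y)
  ... | i , to∘f∘from≡ = from i , λ { ≡.refl → to-inj (to∘f∘from≡ ≡.refl) }

module _ {c ℓ} (M : Monoid c ℓ) where
  open Monoid M
  open import Algebra.Properties.Monoid.Mult M using (_×_; ×-homo-+)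
  open import Algebra.Properties.Monoid.Sum M using (sum; sum-cong-≋; sum-replicate-zero; sum-init-last)
  open import Relation.Binary.Reasoning.Setoid setoid

  ×≈ε⇒*×≈ε : ∀ {x} n k → n × x ≈ ε → (k ℕ.* n) × x ≈ ε
  ×≈ε⇒*×≈ε     n zero    n×x≈ε = refl
  ×≈ε⇒*×≈ε {x} n (suc k) n×x≈ε = begin
    (n ℕ.+ k ℕ.* n) × x    ≈⟨ ×-homo-+ x n (k ℕ.* n) ⟩
    n × x ∙ (k ℕ.* n) × x  ≈⟨ ∙-cong n×x≈ε (×≈ε⇒*×≈ε n k n×x≈ε) ⟩
    ε ∙ ε                  ≈⟨ identityˡ ε ⟩
    ε                      ∎

  bézout-×≈ε⇒≈ε : ∀ {m n i j x} → suc (j ℕ.* n) ≡ i ℕ.* m → m × x ≈ ε → n × x ≈ ε → x ≈ ε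
  bézout-×≈ε⇒≈ε {m} {n} {i} {j} {x} 1+jn≡im m×x≈ε n×x≈ε = begin
    x                    ≈⟨ identityʳ x ⟨
    x ∙ ε                ≈⟨ ∙-congˡ (×≈ε⇒*×≈ε n j n×x≈ε) ⟨
    suc (j ℕ.* n) × x    ≡⟨ ≡.cong (_× x) 1+jn≡im ⟩
    (i ℕ.* m) × x        ≈⟨ ×≈ε⇒*×≈ε m i m×x≈ε ⟩
    ε                    ∎

  coprime-×≈ε⇒≈ε : ∀ {m n x} → Coprime m n → m × x ≈ ε → n × x ≈ ε → x ≈ ε
  coprime-×≈ε⇒≈ε {m} {n} m⊥n m×x≈ε n×x≈ε with coprime-Bézout m⊥n
  ... | GCD.Bézout.+- i j 1+jn≡im = bézout-×≈ε⇒≈ε {m} {n} {i} {j} 1+jn≡im m×x≈ε n×x≈ε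
  ... | GCD.Bézout.-+ i j 1+im≡jn = bézout-×≈ε⇒≈ε {n} {m} {j} {i} 1+im≡jn n×x≈ε m×x≈ε

  sum≈head+last : ∀ {m} (t : Vector Carrier (suc (suc m))) →
                  (∀ i → t (suc (inject₁ i)) ≈ ε) → sum t ≈ t zero ∙ t (fromℕ (suc m))
  sum≈head+last {m} t inner≈ε = ∙-congˡ (begin
    sum (λ i → t (suc i))                                   ≈⟨ sum-init-last (λ i → t (suc i)) ⟩
    sum (λ i → t (suc (inject₁ i))) ∙ t (suc (fromℕ m))
      ≈⟨ ∙-congʳ (trans (sum-cong-≋ inner≈ε) (sum-replicate-zero m)) ⟩
    ε ∙ t (fromℕ (suc m))                                   ≈⟨ identityˡ _ ⟩
    t (fromℕ (suc m))                                       ∎)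

module _ {c ℓ} (M : CommutativeMonoid c ℓ) where
  open CommutativeMonoid M
  open import Algebra.Properties.CommutativeMonoid.Sum M using (sum; sum-cong-≋; sum-remove; sum-replicate; ∑-permute; ∑-distrib-+)
  open import Algebra.Properties.Monoid.Mult monoid using (_×_)
  open import Relation.Binary.Reasoning.Setoid setoid

  sum-permute-scaled : ∀ {n} (f g : Vector Carrier n) (π : Permutation n n) →
                       (∀ i → f (π ⟨$⟩ʳ i) ≈ g i ∙ f i) → sum f ≈ sum g ∙ sum f
  sum-permute-scaled f g π fπ≈gf = begin
    sum f                         ≈⟨ ∑-permute f π ⟩
    sum (λ i → f (π ⟨$⟩ʳ i))      ≈⟨ sum-cong-≋ fπ≈gf ⟩
    sum (λ i → g i ∙ f i)         ≈⟨ ∑-distrib-+ g f ⟩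
    sum g ∙ sum f                 ∎

  ∙-sum-constant-but-one : ∀ {n x} (t : Vector Carrier n) i → t i ≈ ε → (∀ j → j ≢ i → t j ≈ x) →
                           x ∙ sum t ≈ n × x
  ∙-sum-constant-but-one {suc n} {x} t i tᵢ≈ε tⱼ≈x = ∙-congˡ (begin
    sum t                           ≈⟨ sum-remove {i = i} t ⟩
    t i ∙ sum (removeAt t i)        ≈⟨ ∙-cong tᵢ≈ε (sum-cong-≋ (λ j → tⱼ≈x (punchIn i j) (Fin.punchInᵢ≢i i j))) ⟩
    ε ∙ sum {n} (λ _ → x)           ≈⟨ identityˡ _ ⟩
    sum {n} (λ _ → x)               ≈⟨ sum-replicate n ⟩
    n × x                           ∎)

module _ {c ℓ} (R : CommutativeSemiring c ℓ) where
  open CommutativeSemiring R hiding (zero)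
  open import Algebra.Properties.Semiring.Mult semiring using (_×_; ×-assoc-*; ×-congʳ)
  open import Algebra.Properties.Semiring.Exp semiring using (_^_; ^-assocʳ; ^-congˡ)
  open import Algebra.Properties.CommutativeSemiring.Binomial R using (binomialTerm; theorem)
  open import Algebra.Properties.Semiring.Sum semiring using (sum)
  open import Relation.Binary.Reasoning.Setoid setoid

  module _ {p} (p×1≈0 : p × 1# ≈ 0#) where

    p×≈0 : ∀ x → p × x ≈ 0#
    p×≈0 x = begin
      p × x          ≈⟨ ×-congʳ p (*-identityˡ x) ⟨
      p × (1# * x)   ≈⟨ ×-assoc-* p 1# x ⟨
      (p × 1#) * x   ≈⟨ *-congʳ p×1≈0 ⟩
      0# * x         ≈⟨ zeroˡ x ⟩
      0#             ∎

    ∣⇒×≈0 : ∀ {n} x → p ∣ n → n × x ≈ 0#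
    ∣⇒×≈0 x (divides k ≡.refl) = ×≈ε⇒*×≈ε +-monoid p k (p×≈0 x)

  ^-prime-+ : ∀ {p} → Prime p → p × 1# ≈ 0# → ∀ x y → (x + y) ^ p ≈ x ^ p + y ^ p
  ^-prime-+ {zero}      pr = contradiction pr ¬prime[0]
  ^-prime-+ {p@(suc m)} pr p×1≈0 x y = begin
    (x + y) ^ p                                             ≈⟨ theorem p x y ⟩
    sum (binomialTerm x y p)                                ≈⟨ sum≈head+last +-monoid (binomialTerm x y p) inner≈0 ⟩
    binomialTerm x y p zero + binomialTerm x y p (fromℕ p)  ≈⟨ +-cong head≈y^p last≈x^p ⟩
    y ^ p + x ^ p                                           ≈⟨ +-comm (y ^ p) (x ^ p) ⟩
    x ^ p + y ^ p                                           ∎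
    where
    inner≈0 : ∀ i → binomialTerm x y p (suc (inject₁ i)) ≈ 0#
    inner≈0 i = ∣⇒×≈0 p×1≈0 _ (prime∣C pr (s≤s z≤n) (s≤s i<m))
      where
      i<m : Fin.toℕ (inject₁ i) ℕ.< m
      i<m = ≡.subst (ℕ._< m) (≡.sym (Fin.toℕ-inject₁ i)) (Fin.toℕ<n i)
    head≈y^p : binomialTerm x y p zero ≈ y ^ p
    head≈y^p = trans (+-identityʳ _) (*-identityˡ (y ^ p))
    last≈x^p : binomialTerm x y p (fromℕ p) ≈ x ^ p
    last≈x^p = begin
      binomialTerm x y p (fromℕ p)    ≡⟨ ≡.cong (λ k → (p C k) × (x ^ k * y ^ (p ℕ.∸ k))) (Fin.toℕ-fromℕ p) ⟩
      (p C p) × (x ^ p * y ^ (p ℕ.∸ p)) ≡⟨ ≡.cong₂ (λ c k → c × (x ^ p * y ^ k)) (nCn≡1 p) (ℕ.n∸n≡0 p) ⟩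
      1 × (x ^ p * 1#)                ≈⟨ +-identityʳ _ ⟩
      x ^ p * 1#                      ≈⟨ *-identityʳ (x ^ p) ⟩
      x ^ p                           ∎

  ^-prime^-+ : ∀ {p} → Prime p → p × 1# ≈ 0# → ∀ k x y →
               (x + y) ^ (p ℕ.^ k) ≈ x ^ (p ℕ.^ k) + y ^ (p ℕ.^ k)
  ^-prime^-+ pr p×1≈0 0       x y = distribʳ 1# x y
  ^-prime^-+ {p} pr p×1≈0 (suc k) x y = begin
    (x + y) ^ (p ℕ.* q)          ≈⟨ ^-assocʳ (x + y) p q ⟨
    ((x + y) ^ p) ^ q            ≈⟨ ^-congˡ q (^-prime-+ pr p×1≈0 x y) ⟩
    (x ^ p + y ^ p) ^ q          ≈⟨ ^-prime^-+ pr p×1≈0 k (x ^ p) (y ^ p) ⟩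
    (x ^ p) ^ q + (y ^ p) ^ q    ≈⟨ +-cong (^-assocʳ x p q) (^-assocʳ y p q) ⟩
    x ^ (p ℕ.* q) + y ^ (p ℕ.* q) ∎
    where q = p ℕ.^ k

module FiniteFieldProperties {N} (F : FiniteField N) where
  open FiniteField F hiding (_^_)
  open ≡ using (refl; sym; trans; cong; cong₂; module ≡-Reasoning)

  commutativeRing : CommutativeRing 0ℓ 0ℓ
  commutativeRing = record { isCommutativeRing = isCommutativeRing }

  open CommutativeRing commutativeRing public
    using (+-assoc; +-comm; +-identityˡ; +-identityʳ; *-assoc; *-comm; *-identityˡ; *-identityʳ;
           distribʳ; zeroˡ; zeroʳ; commutativeSemiring; semiring; +-monoid; +-commutativeMonoid;
           *-commutativeMonoid)
  open import Algebra.Properties.Semiring.Mult semiring public using (_×_; ×1-homo-*)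
  open import Algebra.Properties.Semiring.Exp semiring public using (_^_)
  open import Algebra.Properties.AbelianGroup (CommutativeRing.+-abelianGroup commutativeRing) public
    using (identityˡ-unique; ∙-cancelʳ; x∙y⁻¹≈ε⇒x≈y; //-rightDividesˡ; //-rightDividesʳ)
  module Π = Algebra.Properties.CommutativeMonoid.Sum *-commutativeMonoid
  module Σ = Algebra.Properties.CommutativeMonoid.Sum +-commutativeMonoid
  open import Algebra.Solver.Ring.NaturalCoefficients.Default commutativeSemiring
  open ≡-Reasoning

  private
    toFin : Carrier → Fin N
    toFin = Inverse.to enumeration
    fromFin : Fin N → Carrier
    fromFin = Inverse.from enumeration

  infix 4 _≟_
  _≟_ : DecidableEquality Carrier
  _≟_ = via-injection (↔⇒↣ enumeration) Fin._≟_

  injective⇒bijective : (f : Carrier → Carrier) → Injective _≡_ _≡_ f → Bijective _≡_ _≡_ f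
  injective⇒bijective = finite-injective⇒bijective enumeration

  1≢0 : 1# ≢ 0#
  1≢0 1≡0 = 0≢1 (sym 1≡0)

  *-cancelˡ : ∀ {x y z} → x ≢ 0# → x * y ≡ x * z → y ≡ z
  *-cancelˡ {x} {y} {z} x≢0 xy≡xz = begin
    y              ≡⟨ *-identityˡ y ⟨
    1# * y         ≡⟨ cong (_* y) x⁻¹x≡1 ⟨
    x⁻¹ * x * y    ≡⟨ *-assoc x⁻¹ x y ⟩
    x⁻¹ * (x * y)  ≡⟨ cong (x⁻¹ *_) xy≡xz ⟩
    x⁻¹ * (x * z)  ≡⟨ *-assoc x⁻¹ x z ⟨
    x⁻¹ * x * z    ≡⟨ cong (_* z) x⁻¹x≡1 ⟩
    1# * z         ≡⟨ *-identityˡ z ⟩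
    z              ∎
    where
    x⁻¹ = proj₁ (inverse x x≢0)
    x⁻¹x≡1 : x⁻¹ * x ≡ 1#
    x⁻¹x≡1 = trans (*-comm x⁻¹ x) (proj₂ (inverse x x≢0))

  *-cancelʳ : ∀ {x y z} → x ≢ 0# → y * x ≡ z * x → y ≡ z
  *-cancelʳ {x} {y} {z} x≢0 yx≡zx = *-cancelˡ x≢0 (trans (*-comm x y) (trans yx≡zx (*-comm z x)))

  x*y≡0⇒y≡0 : ∀ {x y} → x ≢ 0# → x * y ≡ 0# → y ≡ 0#
  x*y≡0⇒y≡0 {x} x≢0 xy≡0 = *-cancelˡ x≢0 (trans xy≡0 (sym (zeroʳ x)))

  *-≢0 : ∀ {x y} → x ≢ 0# → y ≢ 0# → x * y ≢ 0#
  *-≢0 x≢0 y≢0 xy≡0 = y≢0 (x*y≡0⇒y≡0 x≢0 xy≡0)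

  ^≡0⇒≡0 : ∀ {x} n → x ^ n ≡ 0# → x ≡ 0#
  ^≡0⇒≡0         0       1≡0   = contradiction 1≡0 1≢0
  ^≡0⇒≡0 {x} (suc n) x^n+1≡0 with x ≟ 0#
  ... | yes x≡0 = x≡0
  ... | no  x≢0 = ^≡0⇒≡0 n (x*y≡0⇒y≡0 x≢0 x^n+1≡0)

  1#^≡1# : ∀ n → 1# ^ n ≡ 1#
  1#^≡1# 0       = refl
  1#^≡1# (suc n) = trans (*-identityˡ (1# ^ n)) (1#^≡1# n)

  cube≡1 : ∀ {t} → t * t + t + 1# ≡ 0# → t ^ 3 ≡ 1#
  cube≡1 {t} t²+t+1≡0 = ∙-cancelʳ (t * t + t) (t ^ 3) 1# (begin
    t * (t * (t * 1#)) + (t * t + t)        ≡⟨ cong (λ z → t * (t * z) + (t * t + t)) (*-identityʳ t) ⟩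
    t * (t * t) + (t * t + t)               ≡⟨ cong (λ z → t * (t * t) + (t * t + z)) (*-identityʳ t) ⟨
    t * (t * t) + (t * t + t * 1#)
      ≡⟨ solve 2 (λ t o → t :* (t :* t) :+ (t :* t :+ t :* o) := t :* (t :* t :+ t :+ o)) refl t 1# ⟩
    t * (t * t + t + 1#)                    ≡⟨ cong (t *_) t²+t+1≡0 ⟩
    t * 0#                                  ≡⟨ zeroʳ t ⟩
    0#                                      ≡⟨ t²+t+1≡0 ⟨
    t * t + t + 1#                          ≡⟨ +-comm (t * t + t) 1# ⟩
    1# + (t * t + t)                        ∎)

  nontrivial-kernel⇒c²≡xy : ∀ {x y c d D} → d ≢ 0# → x * D + c * d ≡ 0# → y * d + c * D ≡ 0# → c * c ≡ x * y
  nontrivial-kernel⇒c²≡xy {x} {y} {c} {d} {D} d≢0 eq₁ eq₂ =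
    *-cancelʳ d≢0 (∙-cancelʳ (c * x * D) (c * c * d) (x * y * d) (begin
      c * c * d + c * x * D    ≡⟨ solve 4 (λ x c d D → c :* c :* d :+ c :* x :* D := c :* (x :* D :+ c :* d)) refl x c d D ⟩
      c * (x * D + c * d)      ≡⟨ cong (c *_) eq₁ ⟩
      c * 0#                   ≡⟨ zeroʳ c ⟩
      0#                       ≡⟨ zeroʳ x ⟨
      x * 0#                   ≡⟨ cong (x *_) eq₂ ⟨
      x * (y * d + c * D)      ≡⟨ solve 5 (λ x y c d D → x :* (y :* d :+ c :* D) := x :* y :* d :+ c :* x :* D) refl x y c d D ⟩
      x * y * d + c * x * D    ∎))

  permutation : Carrier ↔ Carrier → Permutation N N
  permutation π = enumeration ↔-∘ (π ↔-∘ ↔-sym enumeration)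

  fromFin-permutation : ∀ π i → fromFin (permutation π ⟨$⟩ʳ i) ≡ Inverse.to π (fromFin i)
  fromFin-permutation π i = Inverse.strictlyInverseʳ enumeration (Inverse.to π (fromFin i))

  translation : Carrier → Carrier ↔ Carrier
  translation x = mk↔ₛ′ (_+ x) (_- x) (λ y → //-rightDividesˡ x y) (λ y → //-rightDividesʳ x y)

  N×x≡0 : ∀ x → N × x ≡ 0#
  N×x≡0 x = identityˡ-unique (N × x) S (sym (begin
    S                             ≡⟨ sum-permute-scaled +-commutativeMonoid fromFin (λ _ → x) (permutation (translation x)) shift ⟩
    Σ.sum {N} (λ _ → x) + S       ≡⟨ cong (_+ S) (Σ.sum-replicate N) ⟩
    N × x + S                     ∎))
    where
    S = Σ.sum fromFin
    shift : ∀ i → fromFin (permutation (translation x) ⟨$⟩ʳ i) ≡ x + fromFin i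
    shift i = trans (fromFin-permutation (translation x) i) (+-comm (fromFin i) x)

  scaling : ∀ x → x ≢ 0# → Carrier ↔ Carrier
  scaling x x≢0 = mk↔ₛ′ (x *_) (x⁻¹ *_) (cancel x x⁻¹ xx⁻¹≡1) (cancel x⁻¹ x x⁻¹x≡1)
    where
    x⁻¹ = proj₁ (inverse x x≢0)
    xx⁻¹≡1 : x * x⁻¹ ≡ 1#
    xx⁻¹≡1 = proj₂ (inverse x x≢0)
    x⁻¹x≡1 : x⁻¹ * x ≡ 1#
    x⁻¹x≡1 = trans (*-comm x⁻¹ x) xx⁻¹≡1
    cancel : ∀ u v → u * v ≡ 1# → ∀ y → u * (v * y) ≡ y
    cancel u v uv≡1 y = trans (sym (*-assoc u v y)) (trans (cong (_* y) uv≡1) (*-identityˡ y))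

  -- Lagrange's argument for F^×: scaling by x ≠ 0 permutes F, and counting 0 as 1 (a point that scaling fixes)
  -- keeps every factor of the product invertible.
  unit : Carrier → Carrier
  unit y with y ≟ 0#
  ... | yes _ = 1#
  ... | no  _ = y

  unit≢0 : ∀ y → unit y ≢ 0#
  unit≢0 y with y ≟ 0#
  ... | yes _   = 1≢0
  ... | no  y≢0 = y≢0

  scalingFactor : Carrier → Carrier → Carrier
  scalingFactor x y with y ≟ 0#
  ... | yes _ = 1#
  ... | no  _ = x

  unit-* : ∀ {x} → x ≢ 0# → ∀ y → unit (x * y) ≡ scalingFactor x y * unit y
  unit-* {x} x≢0 y with y ≟ 0# | x * y ≟ 0#
  ... | yes _   | yes _    = sym (*-identityˡ 1#)
  ... | yes y≡0 | no  xy≢0 = contradiction (trans (cong (x *_) y≡0) (zeroʳ x)) xy≢0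
  ... | no  y≢0 | yes xy≡0 = contradiction xy≡0 (*-≢0 x≢0 y≢0)
  ... | no  _   | no  _    = refl

  ∏≢0 : ∀ {n} (f : Fin n → Carrier) → (∀ i → f i ≢ 0#) → Π.sum f ≢ 0#
  ∏≢0 {0}     f f≢0 = 1≢0
  ∏≢0 {suc n} f f≢0 = *-≢0 (f≢0 zero) (∏≢0 (λ i → f (suc i)) (λ i → f≢0 (suc i)))

  x^N≡x : ∀ x → x ^ N ≡ x
  x^N≡x x = begin
    x ^ N          ≡⟨ ∙-sum-constant-but-one *-commutativeMonoid g (toFin 0#) g₀≡1 gⱼ≡x ⟨
    x * Π.sum g    ≡⟨ x*∏g≡x ⟩
    x              ∎
    where
    g : Fin N → Carrier
    g i = scalingFactor x (fromFin i)
    g₀≡1 : g (toFin 0#) ≡ 1#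
    g₀≡1 rewrite Inverse.strictlyInverseʳ enumeration 0# with 0# ≟ 0#
    ... | yes _   = refl
    ... | no  0≢0 = contradiction refl 0≢0
    gⱼ≡x : ∀ j → j ≢ toFin 0# → g j ≡ x
    gⱼ≡x j j≢0 with fromFin j ≟ 0#
    ... | yes j≡0 = contradiction (trans (sym (Inverse.strictlyInverseˡ enumeration j)) (cong toFin j≡0)) j≢0
    ... | no  _   = refl
    ∏g≡1 : x ≢ 0# → Π.sum g ≡ 1#
    ∏g≡1 x≢0 = *-cancelʳ (∏≢0 u (λ i → unit≢0 (fromFin i))) (begin
      Π.sum g * P    ≡⟨ sum-permute-scaled *-commutativeMonoid u g (permutation (scaling x x≢0)) uπ≡gu ⟨
      P              ≡⟨ *-identityˡ P ⟨
      1# * P         ∎)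
      where
      u = λ i → unit (fromFin i)
      P = Π.sum u
      uπ≡gu : ∀ i → u (permutation (scaling x x≢0) ⟨$⟩ʳ i) ≡ g i * u i
      uπ≡gu i = trans (cong unit (fromFin-permutation (scaling x x≢0) i)) (unit-* x≢0 (fromFin i))
    x*∏g≡x : x * Π.sum g ≡ x
    x*∏g≡x with x ≟ 0#
    ... | yes x≡0 = trans (cong (_* Π.sum g) x≡0) (trans (zeroˡ (Π.sum g)) (sym x≡0))
    ... | no  x≢0 = trans (cong (x *_) (∏g≡1 x≢0)) (*-identityʳ x)

  p^k×1#≡[p×1#]^k : ∀ p k → (p ℕ.^ k) × 1# ≡ (p × 1#) ^ k
  p^k×1#≡[p×1#]^k p 0       = +-identityʳ 1#
  p^k×1#≡[p×1#]^k p (suc k) = trans (×1-homo-* p (p ℕ.^ k)) (cong ((p × 1#) *_) (p^k×1#≡[p×1#]^k p k))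

  N≡p^k⇒p×1#≡0 : ∀ {p k} → N ≡ p ℕ.^ k → p × 1# ≡ 0#
  N≡p^k⇒p×1#≡0 {p} {k} N≡p^k = ^≡0⇒≡0 k (begin
    (p × 1#) ^ k      ≡⟨ p^k×1#≡[p×1#]^k p k ⟨
    (p ℕ.^ k) × 1#    ≡⟨ cong (_× 1#) N≡p^k ⟨
    N × 1#            ≡⟨ N×x≡0 1# ⟩
    0#                ∎)

  coprime⇒n×1#≢0 : ∀ {p n} → p × 1# ≡ 0# → Coprime n p → n × 1# ≢ 0#
  coprime⇒n×1#≢0 p×1≡0 n⊥p n×1≡0 = 1≢0 (coprime-×≈ε⇒≈ε +-monoid n⊥p n×1≡0 p×1≡0)

  power≡^ : ∀ x n → FiniteField._^_ F x n ≡ x ^ n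
  power≡^ x 0       = refl
  power≡^ x (suc n) = cong (x *_) (power≡^ x n)

module AlltopPower {N} (F : FiniteField N) {p r : ℕ} (prime-p : Prime p) (5≤p : 5 ≤ p)
                   (N≡p^2r : N ≡ p ℕ.^ (2 ℕ.* r)) (3∤q+1 : ¬ 3 ∣ p ℕ.^ r ℕ.+ 1) where
  open FiniteField F using (Carrier; _+_; _*_; 0#; 1#; _-_; inverse)
  open ≡ using (refl; sym; trans; cong; cong₂; subst; module ≡-Reasoning)
  open FiniteFieldProperties F
  open CommutativeRing commutativeRing using (*-monoid)
  open import Algebra.Properties.Semiring.Exp semiring using (^-homo-*; ^-assocʳ)
  open import Algebra.Properties.CommutativeSemiring.Exp commutativeSemiring using (^-distrib-*)
  open import Algebra.Solver.Ring.NaturalCoefficients.Default commutativeSemiring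
  open ≡-Reasoning

  q : ℕ
  q = p ℕ.^ r

  φ : Carrier → Carrier
  φ x = x ^ q

  p×1#≡0 : p × 1# ≡ 0#
  p×1#≡0 = N≡p^k⇒p×1#≡0 {p} {2 ℕ.* r} N≡p^2r

  φ-+ : ∀ x y → φ (x + y) ≡ φ x + φ y
  φ-+ = ^-prime^-+ commutativeSemiring prime-p p×1#≡0 r

  φ-* : ∀ x y → φ (x * y) ≡ φ x * φ y
  φ-* x y = ^-distrib-* x y q

  φ-involutive : ∀ x → φ (φ x) ≡ x
  φ-involutive x = begin
    (x ^ q) ^ q     ≡⟨ ^-assocʳ x q q ⟩
    x ^ (q ℕ.* q)   ≡⟨ cong (x ^_) q*q≡N ⟩
    x ^ N           ≡⟨ x^N≡x x ⟩
    x               ∎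
    where
    q*q≡N : q ℕ.* q ≡ N
    q*q≡N = sym (begin
      N                       ≡⟨ N≡p^2r ⟩
      p ℕ.^ (r ℕ.+ 1 ℕ.* r)   ≡⟨ ℕ.^-distribˡ-+-* p r (1 ℕ.* r) ⟩
      q ℕ.* p ℕ.^ (1 ℕ.* r)   ≡⟨ cong (λ e → q ℕ.* p ℕ.^ e) (ℕ.*-identityˡ r) ⟩
      q ℕ.* q                 ∎)

  φ-0 : φ 0# ≡ 0#
  φ-0 = identityˡ-unique (φ 0#) (φ 0#) (trans (sym (φ-+ 0# 0#)) (cong φ (+-identityʳ 0#)))

  φ-≢0 : ∀ {x} → x ≢ 0# → φ x ≢ 0#
  φ-≢0 x≢0 φx≡0 = x≢0 (^≡0⇒≡0 q φx≡0)

  2<p : 2 ℕ.< p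
  2<p = ℕ.<-≤-trans (ℕ.s≤s (ℕ.s≤s (ℕ.s≤s ℕ.z≤n))) 5≤p

  3<p : 3 ℕ.< p
  3<p = ℕ.<-≤-trans (ℕ.s≤s (ℕ.s≤s (ℕ.s≤s (ℕ.s≤s ℕ.z≤n)))) 5≤p

  2×1#≢0 : 2 × 1# ≢ 0#
  2×1#≢0 = coprime⇒n×1#≢0 p×1#≡0 (Coprime.sym (prime⇒coprime prime-p 2<p))

  3×1#≢0 : 3 × 1# ≢ 0#
  3×1#≢0 = coprime⇒n×1#≢0 p×1#≡0 (Coprime.sym (prime⇒coprime prime-p 3<p))

  double-injective : ∀ {x y} → x + x ≡ y + y → x ≡ y
  double-injective {x} {y} 2x≡2y = *-cancelˡ 1+1≢0 (begin
    (1# + 1#) * x   ≡⟨ double x ⟩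
    x + x           ≡⟨ 2x≡2y ⟩
    y + y           ≡⟨ double y ⟨
    (1# + 1#) * y   ∎)
    where
    1+1≢0 : 1# + 1# ≢ 0#
    1+1≢0 = 2×1#≢0 ∘ trans (cong (1# +_) (+-identityʳ 1#))
    double : ∀ z → (1# + 1#) * z ≡ z + z
    double z = trans (distribʳ z 1# 1#) (cong₂ _+_ (*-identityˡ z) (*-identityˡ z))

  cube≡1∧norm≡1⇒≡1 : ∀ {t} → t ^ 3 ≡ 1# → t ^ (q ℕ.+ 1) ≡ 1# → t ≡ 1#
  cube≡1∧norm≡1⇒≡1 = coprime-×≈ε⇒≈ε *-monoid (prime∤⇒coprime prime[3] 3∤q+1)
    where
    prime[3] : Prime 3
    prime[3] = from-yes (prime? 3)

  norm≡1⇒t²+t+1≢0 : ∀ {t} → t ^ (q ℕ.+ 1) ≡ 1# → t * t + t + 1# ≢ 0#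
  norm≡1⇒t²+t+1≢0 {t} norm≡1 t²+t+1≡0 = 3×1#≢0 (begin
    1# + (1# + (1# + 0#))   ≡⟨ cong (λ z → 1# + (1# + z)) (+-identityʳ 1#) ⟩
    1# + (1# + 1#)          ≡⟨ +-assoc 1# 1# 1# ⟨
    1# + 1# + 1#            ≡⟨ cong (λ z → z + 1# + 1#) (*-identityˡ 1#) ⟨
    1# * 1# + 1# + 1#       ≡⟨ cong (λ z → z * z + z + 1#) t≡1 ⟨
    t * t + t + 1#          ≡⟨ t²+t+1≡0 ⟩
    0#                      ∎)
    where
    t≡1 : t ≡ 1#
    t≡1 = cube≡1∧norm≡1⇒≡1 (cube≡1 t²+t+1≡0) norm≡1

  norm-φ-quotient : ∀ {u w} → u * w ≡ 1# → (φ u * w) ^ (q ℕ.+ 1) ≡ 1#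
  norm-φ-quotient {u} {w} uw≡1 = begin
    (φ u * w) ^ (q ℕ.+ 1)            ≡⟨ ^-homo-* (φ u * w) q 1 ⟩
    φ (φ u * w) * (φ u * w * 1#)     ≡⟨ cong₂ _*_ (trans (φ-* (φ u) w) (cong (_* φ w) (φ-involutive u))) (*-identityʳ _) ⟩
    u * φ w * (φ u * w)              ≡⟨ solve 4 (λ u W U w → u :* W :* (U :* w) := u :* w :* (U :* W)) refl u (φ w) (φ u) w ⟩
    u * w * (φ u * φ w)              ≡⟨ cong₂ _*_ uw≡1 (sym (φ-* u w)) ⟩
    1# * φ (u * w)                   ≡⟨ cong (λ z → 1# * φ z) uw≡1 ⟩
    1# * φ 1#                        ≡⟨ *-identityˡ (φ 1#) ⟩
    φ 1#                             ≡⟨ 1#^≡1# q ⟩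
    1#                               ∎

  u²+uφu+φu²≢0 : ∀ {u} → u ≢ 0# → u * u + u * φ u + φ u * φ u ≢ 0#
  u²+uφu+φu²≢0 {u} u≢0 u²+uφu+φu²≡0 = norm≡1⇒t²+t+1≢0 (norm-φ-quotient uw≡1) (begin
    t * t + t + 1#                             ≡⟨ cong₂ (λ y z → t * t + y + z) t[uw]≡t [uw][uw]≡1 ⟨
    t * t + t * (u * w) + u * w * (u * w)      ≡⟨ solve 3 (λ u v w → v :* w :* (v :* w) :+ v :* w :* (u :* w) :+ u :* w :* (u :* w)
                                                                  := (u :* u :+ u :* v :+ v :* v) :* (w :* w)) refl u (φ u) w ⟩
    (u * u + u * φ u + φ u * φ u) * (w * w)    ≡⟨ cong (_* (w * w)) u²+uφu+φu²≡0 ⟩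
    0# * (w * w)                               ≡⟨ zeroˡ (w * w) ⟩
    0#                                         ∎)
    where
    w = proj₁ (inverse u u≢0)
    uw≡1 : u * w ≡ 1#
    uw≡1 = proj₂ (inverse u u≢0)
    t = φ u * w
    t[uw]≡t : t * (u * w) ≡ t
    t[uw]≡t = trans (cong (t *_) uw≡1) (*-identityʳ t)
    [uw][uw]≡1 : u * w * (u * w) ≡ 1#
    [uw][uw]≡1 = trans (cong₂ _*_ uw≡1 uw≡1) (*-identityˡ 1#)

  L : Carrier → Carrier → Carrier → Carrier
  L a b x = a * b * φ x + (φ a * b + φ b * a) * x

  L-+ : ∀ a b x y → L a b (x + y) ≡ L a b x + L a b y
  L-+ a b x y = trans (cong (λ z → a * b * z + (φ a * b + φ b * a) * (x + y)) (φ-+ x y))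
    (solve 6 (λ P C X Y x y → P :* (X :+ Y) :+ C :* (x :+ y) := (P :* X :+ C :* x) :+ (P :* Y :+ C :* y))
           refl (a * b) (φ a * b + φ b * a) (φ x) (φ y) x y)

  φ-L : ∀ a b d → φ (L a b d) ≡ φ a * φ b * d + (φ a * b + φ b * a) * φ d
  φ-L a b d = begin
    φ (a * b * φ d + (φ a * b + φ b * a) * d)                  ≡⟨ φ-+ _ _ ⟩
    φ (a * b * φ d) + φ ((φ a * b + φ b * a) * d)              ≡⟨ cong₂ _+_ (φ-* (a * b) (φ d)) (φ-* _ d) ⟩
    φ (a * b) * φ (φ d) + φ (φ a * b + φ b * a) * φ d          ≡⟨ cong₂ (λ x y → x * φ (φ d) + y * φ d) (φ-* a b)
                                                                    (trans (φ-+ _ _) (cong₂ _+_ (φ-* (φ a) b) (φ-* (φ b) a))) ⟩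
    φ a * φ b * φ (φ d) + (φ (φ a) * φ b + φ (φ b) * φ a) * φ d ≡⟨ cong₂ (λ x y → φ a * φ b * x + y * φ d) (φ-involutive d)
                                                                    (cong₂ (λ x y → x * φ b + y * φ a) (φ-involutive a) (φ-involutive b)) ⟩
    φ a * φ b * d + (a * φ b + b * φ a) * φ d
      ≡⟨ solve 6 (λ a b α β d D → α :* β :* d :+ (a :* β :+ b :* α) :* D := α :* β :* d :+ (α :* b :+ β :* a) :* D)
                 refl a b (φ a) (φ b) d (φ d) ⟩
    φ a * φ b * d + (φ a * b + φ b * a) * φ d                  ∎

  L≡0⇒≡0 : ∀ {a b d} → a ≢ 0# → b ≢ 0# → L a b d ≡ 0# → d ≡ 0#
  L≡0⇒≡0 {a} {b} {d} a≢0 b≢0 L≡0 with d ≟ 0#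
  ... | yes d≡0 = d≡0
  ... | no  d≢0 = contradiction (subst (λ v → u * u + u * v + v * v ≡ 0#) (sym φu≡v) u²+uv+v²≡0)
                                (u²+uφu+φu²≢0 (*-≢0 a≢0 (φ-≢0 b≢0)))
    where
    u = a * φ b
    v = φ a * b
    c = φ a * b + φ b * a
    φu≡v : φ u ≡ v
    φu≡v = trans (φ-* a (φ b)) (cong (φ a *_) (φ-involutive b))
    c²≡abφaφb : c * c ≡ a * b * (φ a * φ b)
    c²≡abφaφb = nontrivial-kernel⇒c²≡xy d≢0 L≡0 (trans (sym (φ-L a b d)) (trans (cong φ L≡0) φ-0))
    u²+uv+v²≡0 : u * u + u * v + v * v ≡ 0#
    u²+uv+v²≡0 = ∙-cancelʳ (u * v) (u * u + u * v + v * v) 0# (begin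
      u * u + u * v + v * v + u * v
        ≡⟨ solve 4 (λ a b α β → (a :* β) :* (a :* β) :+ (a :* β) :* (α :* b) :+ (α :* b) :* (α :* b) :+ (a :* β) :* (α :* b)
                                := (α :* b :+ β :* a) :* (α :* b :+ β :* a)) refl a b (φ a) (φ b) ⟩
      c * c                           ≡⟨ c²≡abφaφb ⟩
      a * b * (φ a * φ b)
        ≡⟨ solve 4 (λ a b α β → a :* b :* (α :* β) := (a :* β) :* (α :* b)) refl a b (φ a) (φ b) ⟩
      u * v                           ≡⟨ +-identityˡ (u * v) ⟨
      0# + u * v                      ∎)

  A : Carrier → Carrier
  A x = FiniteField._^_ F x (q ℕ.+ 2)

  A≡φx*xx : ∀ x → A x ≡ φ x * (x * x)
  A≡φx*xx x = begin
    A x                       ≡⟨ power≡^ x (q ℕ.+ 2) ⟩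
    x ^ (q ℕ.+ 2)             ≡⟨ ^-homo-* x q 2 ⟩
    φ x * (x * (x * 1#))      ≡⟨ cong (λ z → φ x * (x * z)) (*-identityʳ x) ⟩
    φ x * (x * x)             ∎

  -- Z stands for φ z; keeping it an independent variable lets the ring solver expand A (z + a).
  ΔA-poly : Carrier → Carrier → Carrier → Carrier
  ΔA-poly a z Z = (a + a) * (Z * z) + a * a * Z + φ a * (z * z) + (a + a) * φ a * z + φ a * (a * a)

  ΔA≡ : ∀ a z → Δ F A a z ≡ ΔA-poly a z (φ z)
  ΔA≡ a z = trans (cong (_- A z) A[z+a]≡) (//-rightDividesʳ (A z) (ΔA-poly a z (φ z)))
    where
    A[z+a]≡ : A (z + a) ≡ ΔA-poly a z (φ z) + A z
    A[z+a]≡ = begin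
      A (z + a)                               ≡⟨ A≡φx*xx (z + a) ⟩
      φ (z + a) * ((z + a) * (z + a))          ≡⟨ cong (λ w → w * ((z + a) * (z + a))) (φ-+ z a) ⟩
      (φ z + φ a) * ((z + a) * (z + a))        ≡⟨ solve 4 (λ z a Z α → (Z :+ α) :* ((z :+ a) :* (z :+ a))
                                                    := ((a :+ a) :* (Z :* z) :+ a :* a :* Z :+ α :* (z :* z) :+ (a :+ a) :* α :* z :+ α :* (a :* a))
                                                       :+ Z :* (z :* z)) refl z a (φ z) (φ a) ⟩
      ΔA-poly a z (φ z) + φ z * (z * z)        ≡⟨ cong (ΔA-poly a z (φ z) +_) (A≡φx*xx z) ⟨
      ΔA-poly a z (φ z) + A z                  ∎

  K : Carrier → Carrier → Carrier
  K a b = (a + a) * (φ b * b) + a * a * φ b + φ a * (b * b) + (a + a) * φ a * b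

  ΔΔA≡ : ∀ a b x → Δ F (Δ F A a) b x ≡ (L a b x + L a b x) + K a b
  ΔΔA≡ a b x = begin
    Δ F A a (x + b) - Δ F A a x                                    ≡⟨ cong₂ _-_ (ΔA≡ a (x + b)) (ΔA≡ a x) ⟩
    ΔA-poly a (x + b) (φ (x + b)) - ΔA-poly a x (φ x)              ≡⟨ cong (λ w → ΔA-poly a (x + b) w - ΔA-poly a x (φ x)) (φ-+ x b) ⟩
    ΔA-poly a (x + b) (φ x + φ b) - ΔA-poly a x (φ x)              ≡⟨ cong (_- ΔA-poly a x (φ x)) expand ⟩
    (L a b x + L a b x) + K a b + ΔA-poly a x (φ x) - ΔA-poly a x (φ x) ≡⟨ //-rightDividesʳ _ _ ⟩
    (L a b x + L a b x) + K a b                   ∎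
    where
    expand : ΔA-poly a (x + b) (φ x + φ b) ≡ (L a b x + L a b x) + K a b + ΔA-poly a x (φ x)
    expand = solve 6 (λ x b X β a α →
      (a :+ a) :* ((X :+ β) :* (x :+ b)) :+ a :* a :* (X :+ β) :+ α :* ((x :+ b) :* (x :+ b)) :+ (a :+ a) :* α :* (x :+ b) :+ α :* (a :* a)
      := ((a :* b :* X :+ (α :* b :+ β :* a) :* x) :+ (a :* b :* X :+ (α :* b :+ β :* a) :* x))
           :+ ((a :+ a) :* (β :* b) :+ a :* a :* β :+ α :* (b :* b) :+ (a :+ a) :* α :* b)
         :+ ((a :+ a) :* (X :* x) :+ a :* a :* X :+ α :* (x :* x) :+ (a :+ a) :* α :* x :+ α :* (a :* a)))
      refl x b (φ x) (φ b) a (φ a)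

  ΔΔA-injective : ∀ {a b} → a ≢ 0# → b ≢ 0# → Injective _≡_ _≡_ (Δ F (Δ F A a) b)
  ΔΔA-injective {a} {b} a≢0 b≢0 {x} {y} ΔΔAx≡ΔΔAy = x∙y⁻¹≈ε⇒x≈y x y (L≡0⇒≡0 a≢0 b≢0 L[x-y]≡0)
    where
    Lx≡Ly : L a b x ≡ L a b y
    Lx≡Ly = double-injective (∙-cancelʳ (K a b) _ _ (trans (sym (ΔΔA≡ a b x)) (trans ΔΔAx≡ΔΔAy (ΔΔA≡ a b y))))
    L[x-y]≡0 : L a b (x - y) ≡ 0#
    L[x-y]≡0 = ∙-cancelʳ (L a b y) (L a b (x - y)) 0# (begin
      L a b (x - y) + L a b y    ≡⟨ L-+ a b (x - y) y ⟨
      L a b (x - y + y)          ≡⟨ cong (L a b) (//-rightDividesˡ y x) ⟩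
      L a b x                    ≡⟨ Lx≡Ly ⟩
      L a b y                    ≡⟨ +-identityˡ (L a b y) ⟨
      0# + L a b y               ∎)

open import Data.Nat using (_+_; _*_; _^_)

theorem4 : (p r : ℕ) → Prime p → 5 ≤ p → 1 ≤ r → ¬ (3 ∣ p ^ r + 1) →
           (F : FiniteField (p ^ (2 * r))) →
           Alltop F (λ x → FiniteField._^_ F x (p ^ r + 2))
theorem4 p r prime-p 5≤p _ 3∤q+1 F a a≢0 b b≢0 = injective⇒bijective _ (ΔΔA-injective a≢0 b≢0)
  where
  open FiniteFieldProperties F using (injective⇒bijective)
  open AlltopPower F {p} {r} prime-p 5≤p ≡.refl 3∤q+1 using (ΔΔA-injective)
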